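{- Let $D$ be a negative integer with $D\equiv 0$ or $1\pmod 4$, and let $\mathcal{O}$ be the order of discriminant $D$ in $K=\mathbb{Q}(\sqrt{D})$. Let $d=-D$ if $D$ is odd and $d=-D/4$ if $D$ is even, and define $\tau_D=\frac{ -3+\sqrt{ -d}}{2}$ if $D\equiv 1\pmod 8$, $\tau_D=\frac{3+\sqrt{ -d}}{2}$ if $D\equiv 5\pmod 8$, $\tau_D=3+\sqrt{ -d}$ if $D\equiv 4$ or $8\pmod{32}$, and $\tau_D=\sqrt{ -d}$ otherwise (so $\mathcal{O}=\mathbb{Z}+\mathbb{Z}\tau_D$). Then the map $\epsilon_{\tau_D}:\mathcal{O}_2^\times\to\boldsymbol{\mu}_4$ is given as follows (congruences modulo $4\mathcal{O}_2$): - $D$ odd: $\epsilon_{\tau_D}(\lambda)=1$ if $\lambda^3\equiv 1$ or $-\sqrt{ -d}$; $=-1$ if $\lambda^3\equiv -1$ or $\sqrt{ -d}$. - $D\equiv 4\pmod{16}$: $=1$ if $\lambda\equiv 1,\sqrt{ -d},-1+2\sqrt{ -d},2-\sqrt{ -d}$; $=-1$ if $\lambda\equiv -1,-\sqrt{ -d},1+2\sqrt{ -d},2+\sqrt{ -d}$. - $D\equiv 8\pmod{16}$: $=1$ if $\lambda\equiv 1,-1+2\sqrt{ -d},1+\sqrt{ -d},-1+\sqrt{ -d}$; $=-1$ if $\lambda\equiv -1,1+2\sqrt{ -d},1-\sqrt{ -d},-1-\sqrt{ -d}$. - $D\equiv 12\pmod{16}$: $=1$ if $\lambda\equiv 1,1+2\sqrt{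 -d}$; $=i$ if $\lambda\equiv 2+\sqrt{ -d},\sqrt{ -d}$; $=-1$ if $\lambda\equiv -1,-1+2\sqrt{ -d}$; $=-i$ if $\lambda\equiv 2-\sqrt{ -d},-\sqrt{ -d}$. - $D\equiv 0\pmod{16}$: $=1$ if $\lambda\equiv 1,-1+2\sqrt{ -d}$; $=i$ if $\lambda\equiv 1-\sqrt{ -d},-1-\sqrt{ -d}$; $=-1$ if $\lambda\equiv -1,1+2\sqrt{ -d}$; $=-i$ if $\lambda\equiv 1+\sqrt{ -d},-1+\sqrt{ -d}$.
   Context: $i$ and $\sqrt{ -d}$ are the square roots in the upper half-plane. $\mathcal{O}_2=\mathcal{O}\otimes\mathbb{Z}_2$. For $\tau$ in the upper half-plane with $\tau\in K$, let $\mathcal{O}_\tau=\{\alpha\in K:\alpha(\mathbb{Z}+\mathbb{Z}\tau)\subseteq\mathbb{Z}+\mathbb{Z}\tau\}$ with discriminant $D(\tau)$; let $q_\tau:K\to M_2(\mathbb{Q})$ be defined by $q_\tau(\mu)\binom{\tau}{1}=\binom{\mu\tau}{\mu}$, extended to $K\otimes\mathbb{Q}_2\to M_2(\mathbb{Q}_2)$; let $\phi:\mathrm{SL}_2(\mathbb{Z}/4\mathbb{Z})\to\boldsymbol{\mu}_4$ be the homomorphism with $\phi\begin{pmatrix}1&1\\0&1\end{pmatrix}=i$; for $\lambda\in(\mathcal{O}_\tau\otimes\mathbb{Z}_2)^\times$ let $\delta_\tau(\lambda)=\phi$ of the reduction mod 4 of $\begin{pmatrix}1&0\\0&\mathrm{N}_{K/\mathbb{Q}}(\lambda)^{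 -1}\end{pmatrix}q_\tau(\lambda)\in\mathrm{SL}_2(\mathbb{Z}_2)$, and $\epsilon_\tau(\lambda)=i^{(\mathrm{N}_{K/\mathbb{Q}}(\lambda)-1)/2}\delta_\tau(\lambda)$ if $D(\tau)\equiv 4$ or $8\pmod{16}$, $\epsilon_\tau(\lambda)=\delta_\tau(\lambda)$ otherwise. -}

module Defs where

open import Data.Nat as ℕ using (ℕ; zero; suc)
open import Data.Nat.DivMod using (_mod_)
open import Data.Integer hiding (suc)
open import Data.Integer.Divisibility using (_∣_)
open import Data.Fin as Fin using (Fin; toℕ)
open import Data.Bool using (Bool; true; false; if_then_else_; _∨_)
open import Data.Product using (Σ; _×_; _,_; proj₁; proj₂)
open import Relation.Binary.PropositionalEquality using (_≡_)

-- ℤ/4ℤ, represented as Fin 4, with ring operations; μ₄ is represented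
-- by exponents k ∈ ℤ/4ℤ standing for i^k (group law = addition).

infixl 6 _+₄_
infixl 7 _*₄_
infixl 6 _+₂_ _-₂_
infixl 7 _*₂_

Z4 : Set
Z4 = Fin 4

red4 : ℤ → Z4
red4 z = (z %ℕ 4) mod 4

lift4 : Z4 → ℤ
lift4 x = + toℕ x

_+₄_ : Z4 → Z4 → Z4
x +₄ y = red4 (lift4 x + lift4 y)

_*₄_ : Z4 → Z4 → Z4
x *₄ y = red4 (lift4 x * lift4 y)

-- inverse in ℤ/4ℤ of a unit (junk value 0 on non-units)
inv4 : Z4 → Z4
inv4 Fin.zero = Fin.zero
inv4 (Fin.suc Fin.zero) = Fin.suc Fin.zero
inv4 (Fin.suc (Fin.suc Fin.zero)) = Fin.zero
inv4 (Fin.suc (Fin.suc (Fin.suc Fin.zero))) = Fin.suc (Fin.suc (Fin.suc Fin.zero))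

record M2 : Set where
  constructor mat
  field
    m11 m12 m21 m22 : Z4
open M2 public

_·M_ : M2 → M2 → M2
A ·M B = mat (m11 A *₄ m11 B +₄ m12 A *₄ m21 B) (m11 A *₄ m12 B +₄ m12 A *₄ m22 B)
             (m21 A *₄ m11 B +₄ m22 A *₄ m21 B) (m21 A *₄ m12 B +₄ m22 A *₄ m22 B)

detM : M2 → Z4
detM A = red4 (lift4 (m11 A) * lift4 (m22 A) - lift4 (m12 A) * lift4 (m21 A))

oneZ4 : Z4
oneZ4 = Fin.suc Fin.zero

Tmat : M2
Tmat = mat oneZ4 oneZ4 Fin.zero oneZ4

IsPhi : (M2 → Z4) → Set
IsPhi φ = ((A B : M2) → detM A ≡ oneZ4 → detM B ≡ oneZ4 → φ (A ·M B) ≡ φ A +₄ φ B)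
          × φ Tmat ≡ oneZ4

-- 2-adic integers ℤ₂ as coherent sequences of integers: x n is a
-- representative of x modulo 2^n.

Z2raw : Set
Z2raw = ℕ → ℤ

IsZ2 : Z2raw → Set
IsZ2 x = (n : ℕ) → (+ (2 ℕ.^ n)) ∣ (x (suc n) - x n)

_≈₂_ : Z2raw → Z2raw → Set
x ≈₂ y = (n : ℕ) → (+ (2 ℕ.^ n)) ∣ (x n - y n)

const₂ : ℤ → Z2raw
const₂ z _ = z

_+₂_ _-₂_ _*₂_ : Z2raw → Z2raw → Z2raw
(x +₂ y) n = x n + y n
(x -₂ y) n = x n - y n
(x *₂ y) n = x n * y n

-- The data of τ_D:  O = ℤ + ℤ τ_D, τ_D² = tr · τ_D − nm.

isOdd : ℤ → Bool
isOdd D = (D %ℕ 2) ℕ.≡ᵇ 1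

case3 : ℤ → Bool
case3 D = ((D %ℕ 32) ℕ.≡ᵇ 4) ∨ ((D %ℕ 32) ℕ.≡ᵇ 8)

dOf : ℤ → ℤ
dOf D = if isOdd D then - D else (- D) /ℕ 4

trτ : ℤ → ℤ
trτ D = if isOdd D then (if (D %ℕ 8) ℕ.≡ᵇ 1 then - + 3 else + 3)
        else (if case3 D then + 6 else + 0)

nmτ : ℤ → ℤ
nmτ D = if isOdd D then (+ 9 + dOf D) /ℕ 4
        else (if case3 D then + 9 + dOf D else dOf D)

-- elements of O₂ = ℤ₂ + ℤ₂ τ_D : pairs (a , b) standing for a + b τ_D
O2 : Set
O2 = Z2raw × Z2raw

IsO2 : O2 → Set
IsO2 (a , b) = IsZ2 a × IsZ2 b

_≈O_ : O2 → O2 → Set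
(a , b) ≈O (c , d) = (a ≈₂ c) × (b ≈₂ d)

constO : ℤ → ℤ → O2
constO x y = (const₂ x , const₂ y)

oneO : O2
oneO = constO (+ 1) (+ 0)

negO : O2 → O2
negO (a , b) = (const₂ (+ 0) -₂ a , const₂ (+ 0) -₂ b)

_-O_ : O2 → O2 → O2
(a , b) -O (c , d) = (a -₂ c , b -₂ d)

mulO : ℤ → O2 → O2 → O2
mulO D (a , b) (c , d) =
  ( a *₂ c -₂ const₂ (nmτ D) *₂ (b *₂ d)
  , a *₂ d +₂ b *₂ c +₂ const₂ (trτ D) *₂ (b *₂ d) )

cubeO : ℤ → O2 → O2
cubeO D l = mulO D l (mulO D l l)

sqrtO : ℤ → O2
sqrtO D = if isOdd D then (if (D %ℕ 8) ℕ.≡ᵇ 1 then constO (+ 3) (+ 2) else constO (- + 3) (+ 2))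
          else (if case3 D then constO (- + 3) (+ 1) else constO (+ 0) (+ 1))

IsUnitO : ℤ → O2 → Set
IsUnitO D l = Σ O2 λ m → IsO2 m × (mulO D l m ≈O oneO)

Cong4 : O2 → O2 → Set
Cong4 x y = Σ O2 λ v → IsO2 v × ((x -O y) ≈O (mulO4 v))
  where
  mulO4 : O2 → O2
  mulO4 (a , b) = (const₂ (+ 4) *₂ a , const₂ (+ 4) *₂ b)

normO : ℤ → O2 → Z2raw
normO D (a , b) = a *₂ a +₂ const₂ (trτ D) *₂ (a *₂ b) +₂ const₂ (nmτ D) *₂ (b *₂ b)

-- q_τ(a + bτ) = ( a + tr·b   -nm·b ; b   a ), since
-- (a + bτ) τ = (a + tr b) τ - nm b.
-- reduction mod 4 of diag(1, N(λ)⁻¹) q_τ(λ); reduction mod 4 of a ℤ₂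
-- element x is red4 (x 2).
δmat : ℤ → O2 → M2
δmat D l@(a , b) =
  mat (red4 (a 2 + trτ D * b 2)) (red4 (- (nmτ D * b 2)))
      (Ninv *₄ red4 (b 2)) (Ninv *₄ red4 (a 2))
  where
  Ninv : Z4
  Ninv = inv4 (red4 (normO D l 2))

δτ : ℤ → (M2 → Z4) → O2 → Z4
δτ D φ l = φ (δmat D l)

halfExp : ℤ → O2 → Z4
halfExp D l = ((normO D l 3 %ℕ 8) ℕ.∸ 1) ℕ./ 2 mod 4

D4or8 : ℤ → Bool
D4or8 D = ((D %ℕ 16) ℕ.≡ᵇ 4) ∨ ((D %ℕ 16) ℕ.≡ᵇ 8)

ετ : ℤ → (M2 → Z4) → O2 → Z4
ετ D φ l = if D4or8 D then halfExp D l +₄ δτ D φ l else δτ D φ l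

μ1 μi μ-1 μ-i : Z4
μ1 = Fin.zero
μi = Fin.suc Fin.zero
μ-1 = Fin.suc (Fin.suc Fin.zero)
μ-i = Fin.suc (Fin.suc (Fin.suc Fin.zero))

_+O_ : O2 → O2 → O2
(a , b) +O (c , d) = (a +₂ c , b +₂ d)

elt : ℤ → ℤ → ℤ → O2
elt D x y = constO x (+ 0) +O mulO D (constO y (+ 0)) (sqrtO D)

-- ε_τ(λ) depends only on D modulo 32 and on λ modulo 4. Indeed trace and norm of τ_D and √-d are
-- determined by D modulo 32 (the norm modulo 8), δ only reads λ modulo 4, and the norm of λ enters
-- ε modulo 8 only when D ≡ 4, 8 (mod 16); then the trace of τ_D is even, so this norm is again a
-- function of λ modulo 4. Moreover φ is unique: SL₂(ℤ/4ℤ) is generated by T and S, the relation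
-- (ST)³ = S² forces φ(S) = i, and every matrix of determinant 1 is a word Tˣ S Tʸ Sᶻ. Each case of
-- the theorem is therefore a finite statement about residues, decided by evaluation.

module Submission where

open import Defs
open import Data.Nat as ℕ using (ℕ; zero; suc)
import Data.Nat.Properties as ℕ
open import Data.Nat.Divisibility as ℕ using (divides)
open import Data.Nat.DivMod using (_mod_; m<n⇒m%n≡m)
open import Data.Integer using (ℤ; +_; -[1+_]; -_; _+_; _-_; _*_; _<_; _%ℕ_; _/ℕ_)
open import Data.Integer.Properties using (+-injective; pos-+; pos-*; *-cancelʳ-≡)
open import Data.Integer.DivMod using (a≡a%ℕn+[a/ℕn]*n; n%ℕd<d)
import Data.Integer.Divisibility as Unsigned
import Data.Integer.Divisibility.Signed as Signed
open import Data.Integer.Tactic.RingSolver using (solve-∀)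
open import Data.Bool using (true; false; _∨_)
import Data.Bool.Properties as Bool
open import Data.Fin as Fin using (Fin; toℕ)
open import Data.Fin.Properties using (toℕ-fromℕ<; all?) renaming (_≟_ to _≟₄_)
open import Data.List using (List; []; _∷_; _++_; foldr; replicate)
open import Data.List.Relation.Unary.Any as Any using (Any; here; there; any?)
open import Data.Product using (_×_; _,_; proj₁; proj₂; uncurry)
open import Data.Product.Properties using (≡-dec)
open import Data.Sum as Sum using (_⊎_; inj₁; inj₂)
open import Data.Empty using (⊥; ⊥-elim)
open import Relation.Nullary.Decidable using (Dec; True; map′; toWitness; from-yes; _×-dec_; _⊎-dec_; _→-dec_)
open import Relation.Binary.Definitions using (DecidableEquality)
open import Relation.Binary.PropositionalEquality
open ≡-Reasoning

-- Congruences of integers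

infix 4 _≡_[mod_]
record _≡_[mod_] (x y : ℤ) (n : ℕ) : Set where
  constructor by
  field
    quotient : ℤ
    equation : x ≡ y + quotient * + n

module _ {n : ℕ} where

  ≡-mod-reflexive : ∀ {x y} → x ≡ y → x ≡ y [mod n ]
  ≡-mod-reflexive {x} refl = by (+ 0) (identity x (+ n))
    where
    identity : ∀ x N → x ≡ x + + 0 * N
    identity = solve-∀

  ≡-mod-refl : ∀ {x} → x ≡ x [mod n ]
  ≡-mod-refl = ≡-mod-reflexive refl

  ≡-mod-sym : ∀ {x y} → x ≡ y [mod n ] → y ≡ x [mod n ]
  ≡-mod-sym {y = y} (by k refl) = by (- k) (identity y k (+ n))
    where
    identity : ∀ y k N → y ≡ (y + k * N) + (- k) * N
    identity = solve-∀

  ≡-mod-trans : ∀ {x y z} → x ≡ y [mod n ] → y ≡ z [mod n ] → x ≡ z [mod n ]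
  ≡-mod-trans {z = z} (by k refl) (by j refl) = by (j + k) (identity z j k (+ n))
    where
    identity : ∀ z j k N → (z + j * N) + k * N ≡ z + (j + k) * N
    identity = solve-∀

  +-cong-mod : ∀ {x x′ y y′} → x ≡ x′ [mod n ] → y ≡ y′ [mod n ] → x + y ≡ x′ + y′ [mod n ]
  +-cong-mod {x′ = x′} {y′ = y′} (by k refl) (by j refl) = by (k + j) (identity x′ y′ k j (+ n))
    where
    identity : ∀ x y k j N → (x + k * N) + (y + j * N) ≡ (x + y) + (k + j) * N
    identity = solve-∀

  *-cong-mod : ∀ {x x′ y y′} → x ≡ x′ [mod n ] → y ≡ y′ [mod n ] → x * y ≡ x′ * y′ [mod n ]
  *-cong-mod {x′ = x′} {y′ = y′} (by k refl) (by j refl) =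
    by (k * y′ + x′ * j + k * j * + n) (identity x′ y′ k j (+ n))
    where
    identity : ∀ x y k j N → (x + k * N) * (y + j * N) ≡ x * y + (k * y + x * j + k * j * N) * N
    identity = solve-∀

  neg-cong-mod : ∀ {x x′} → x ≡ x′ [mod n ] → - x ≡ - x′ [mod n ]
  neg-cong-mod {x′ = x′} (by k refl) = by (- k) (identity x′ k (+ n))
    where
    identity : ∀ x k N → - (x + k * N) ≡ - x + (- k) * N
    identity = solve-∀

  -‿cong-mod : ∀ {x x′ y y′} → x ≡ x′ [mod n ] → y ≡ y′ [mod n ] → x - y ≡ x′ - y′ [mod n ]
  -‿cong-mod p q = +-cong-mod p (neg-cong-mod q)

  ∣⇒≡-mod : ∀ {x y} → + n Unsigned.∣ x - y → x ≡ y [mod n ]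
  ∣⇒≡-mod {x} {y} n∣x-y with Signed.∣ᵤ⇒∣ n∣x-y
  ... | Signed.divides q eq = by q (trans (identity x y) (cong (_+_ y) eq))
    where
    identity : ∀ x y → x ≡ y + (x - y)
    identity = solve-∀

  ∣-multiple⇒≡-mod : ∀ {x y w} → + n Unsigned.∣ (x - y) - + n * w → x ≡ y [mod n ]
  ∣-multiple⇒≡-mod {x} {y} {w} n∣ with ∣⇒≡-mod n∣
  ... | by q eq = by (w + q) (trans (identity x y) (trans (cong (_+_ y) eq) (identity′ y w q (+ n))))
    where
    identity : ∀ x y → x ≡ y + (x - y)
    identity = solve-∀
    identity′ : ∀ y w q N → y + (N * w + q * N) ≡ y + (w + q) * N
    identity′ = solve-∀

≡-mod-weaken : ∀ {m n x y} → n ℕ.∣ m → x ≡ y [mod m ] → x ≡ y [mod n ]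
≡-mod-weaken {n = n} {y = y} (divides q refl) (by k refl) = by (k * + q) (cong (_+_ y) (begin
  k * + (q ℕ.* n)   ≡⟨ cong (k *_) (pos-* q n) ⟩
  k * (+ q * + n)   ≡⟨ identity k (+ q) (+ n) ⟩
  k * + q * + n     ∎))
  where
  identity : ∀ k Q N → k * (Q * N) ≡ k * Q * N
  identity = solve-∀

no-wraparound : ∀ {n r r′} j → r ℕ.< n → + r ≡ + r′ + + suc j * + n → ⊥
no-wraparound {n} {r} {r′} j r<n e = ℕ.<⇒≱ r<n n≤r
  where
  r≡ : r ≡ r′ ℕ.+ suc j ℕ.* n
  r≡ = +-injective (trans e (sym (trans (pos-+ r′ _) (cong (_+_ (+ r′)) (pos-* (suc j) n)))))
  n≤r : n ℕ.≤ r
  n≤r = subst (n ℕ.≤_) (sym r≡) (ℕ.≤-trans (ℕ.m≤m+n n (j ℕ.* n)) (ℕ.m≤n+m _ r′))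

remainder-unique : ∀ {n r r′} k → r ℕ.< n → r′ ℕ.< n → + r ≡ + r′ + k * + n → r ≡ r′
remainder-unique {n} {r} {r′} (+ zero) _ _ e = +-injective (trans e (identity (+ r′) (+ n)))
  where
  identity : ∀ r N → r + + 0 * N ≡ r
  identity = solve-∀
remainder-unique (+ suc j) r<n _ e = ⊥-elim (no-wraparound j r<n e)
remainder-unique {n} {r} {r′} -[1+ j ] _ r′<n e =
  ⊥-elim (no-wraparound j r′<n (trans (identity (+ r′) (+ suc j) (+ n)) (cong (_+ + suc j * + n) (sym e))))
  where
  identity : ∀ r K N → r ≡ (r + (- K) * N) + K * N
  identity = solve-∀

%ℕ-cong : ∀ {x y} n .{{_ : ℕ.NonZero n}} → x ≡ y [mod n ] → x %ℕ n ≡ y %ℕ n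
%ℕ-cong {x} {y} n (by k x≡) =
  remainder-unique (y /ℕ n + k - x /ℕ n) (n%ℕd<d x n) (n%ℕd<d y n) (begin
    + (x %ℕ n)                                       ≡⟨ identity (+ (x %ℕ n)) (x /ℕ n) (+ n) ⟩
    (+ (x %ℕ n) + x /ℕ n * + n) - x /ℕ n * + n        ≡⟨ cong (_- x /ℕ n * + n) (sym (a≡a%ℕn+[a/ℕn]*n x n)) ⟩
    x - x /ℕ n * + n                                 ≡⟨ cong (_- x /ℕ n * + n) x≡ ⟩
    (y + k * + n) - x /ℕ n * + n                     ≡⟨ cong (λ t → (t + k * + n) - x /ℕ n * + n) (a≡a%ℕn+[a/ℕn]*n y n) ⟩
    (+ (y %ℕ n) + y /ℕ n * + n + k * + n) - x /ℕ n * + n ≡⟨ identity′ (+ (y %ℕ n)) (y /ℕ n) k (x /ℕ n) (+ n) ⟩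
    + (y %ℕ n) + (y /ℕ n + k - x /ℕ n) * + n          ∎)
  where
  identity : ∀ r q N → r ≡ (r + q * N) - q * N
  identity = solve-∀
  identity′ : ∀ r q k q′ N → (r + q * N + k * N) - q′ * N ≡ r + (q + k - q′) * N
  identity′ = solve-∀

≡-mod-remainder : ∀ n .{{_ : ℕ.NonZero n}} x → x ≡ + toℕ ((x %ℕ n) mod n) [mod n ]
≡-mod-remainder n x = by (x /ℕ n) (begin
  x                                   ≡⟨ a≡a%ℕn+[a/ℕn]*n x n ⟩
  + (x %ℕ n) + x /ℕ n * + n            ≡⟨ cong (λ r → + r + x /ℕ n * + n) (sym (trans (toℕ-fromℕ< _) (m<n⇒m%n≡m (n%ℕd<d x n)))) ⟩
  + toℕ ((x %ℕ n) mod n) + x /ℕ n * + n ∎)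

/ℕ-cong : ∀ {x y} d m .{{_ : ℕ.NonZero d}} → x ≡ y [mod d ℕ.* m ] → x /ℕ d ≡ y /ℕ d [mod m ]
/ℕ-cong {x} {y} d m x≡y@(by k x≡) = by k (*-cancelʳ-≡ _ _ (+ d) (begin
  x /ℕ d * + d                                 ≡⟨ quotient-part x ⟩
  x - + (x %ℕ d)                               ≡⟨ cong₂ _-_ x≡ (cong +_ (%ℕ-cong d (≡-mod-weaken (ℕ.m∣m*n m) x≡y))) ⟩
  (y + k * + (d ℕ.* m)) - + (y %ℕ d)           ≡⟨ cong (λ t → (t + k * + (d ℕ.* m)) - + (y %ℕ d)) (a≡a%ℕn+[a/ℕn]*n y d) ⟩
  (+ (y %ℕ d) + y /ℕ d * + d + k * + (d ℕ.* m)) - + (y %ℕ d) ≡⟨ cong (λ t → (+ (y %ℕ d) + y /ℕ d * + d + k * t) - + (y %ℕ d)) (pos-* d m) ⟩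
  (+ (y %ℕ d) + y /ℕ d * + d + k * (+ d * + m)) - + (y %ℕ d) ≡⟨ identity (+ (y %ℕ d)) (y /ℕ d) k (+ d) (+ m) ⟩
  (y /ℕ d + k * + m) * + d                     ∎))
  where
  quotient-part : ∀ z → z /ℕ d * + d ≡ z - + (z %ℕ d)
  quotient-part z = trans (identity′ (+ (z %ℕ d)) (z /ℕ d * + d)) (cong (_- + (z %ℕ d)) (sym (a≡a%ℕn+[a/ℕn]*n z d)))
    where
    identity′ : ∀ r p → p ≡ (r + p) - r
    identity′ = solve-∀
  identity : ∀ r q k D M → (r + q * D + k * (D * M)) - r ≡ (q + k * M) * D
  identity = solve-∀

square-cong-mod8 : ∀ {x y} → x ≡ y [mod 4 ] → x * x ≡ y * y [mod 8 ]
square-cong-mod8 {y = y} (by k refl) = by (y * k + k * k * + 2) (identity y k)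
  where
  identity : ∀ y k → (y + k * + 4) * (y + k * + 4) ≡ y * y + (y * k + k * k * + 2) * + 8
  identity = solve-∀

even-*-cong-mod8 : ∀ {t x y} → t %ℕ 2 ≡ 0 → x ≡ y [mod 4 ] → t * x ≡ t * y [mod 8 ]
even-*-cong-mod8 {t} {y = y} t-even (by k refl) = by (t /ℕ 2 * k) (begin
  t * (y + k * + 4)                      ≡⟨ cong (_* (y + k * + 4)) t≡ ⟩
  (+ 0 + t /ℕ 2 * + 2) * (y + k * + 4)   ≡⟨ identity (t /ℕ 2) y k ⟩
  (+ 0 + t /ℕ 2 * + 2) * y + t /ℕ 2 * k * + 8 ≡⟨ cong (λ t′ → t′ * y + t /ℕ 2 * k * + 8) (sym t≡) ⟩
  t * y + t /ℕ 2 * k * + 8               ∎)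
  where
  t≡ : t ≡ + 0 + t /ℕ 2 * + 2
  t≡ = trans (a≡a%ℕn+[a/ℕn]*n t 2) (cong (λ r → + r + t /ℕ 2 * + 2) t-even)
  identity : ∀ s y k → (+ 0 + s * + 2) * (y + k * + 4) ≡ (+ 0 + s * + 2) * y + s * k * + 8
  identity = solve-∀

red4-cong : ∀ {x y} → x ≡ y [mod 4 ] → red4 x ≡ red4 y
red4-cong x≡y = cong (_mod 4) (%ℕ-cong 4 x≡y)

-- SL₂(ℤ/4ℤ) and its character φ

pattern 0₄ = Fin.zero
pattern 1₄ = Fin.suc Fin.zero
pattern 2₄ = Fin.suc (Fin.suc Fin.zero)
pattern 3₄ = Fin.suc (Fin.suc (Fin.suc Fin.zero))

_≟M_ : DecidableEquality M2
mat a b c d ≟M mat a′ b′ c′ d′ =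
  map′ (λ { (refl , refl , refl , refl) → refl }) (λ { refl → refl , refl , refl , refl })
       (a ≟₄ a′ ×-dec b ≟₄ b′ ×-dec c ≟₄ c′ ×-dec d ≟₄ d′)

mat-cong : ∀ {a b c d a′ b′ c′ d′} → a ≡ a′ → b ≡ b′ → c ≡ c′ → d ≡ d′ → mat a b c d ≡ mat a′ b′ c′ d′
mat-cong refl refl refl refl = refl

all-M2? : {P : M2 → Set} → ((M : M2) → Dec (P M)) → Dec ((M : M2) → P M)
all-M2? P? = map′ (λ h → λ { (mat a b c d) → h a b c d }) (λ h a b c d → h (mat a b c d))
                  (all? λ a → all? λ b → all? λ c → all? λ d → P? (mat a b c d))

data Generator : Set where
  T S : Generator

Smat : M2
Smat = mat 0₄ 3₄ 1₄ 0₄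

Imat : M2
Imat = mat 1₄ 0₄ 0₄ 1₄

⟦_⟧ : Generator → M2
⟦ T ⟧ = Tmat
⟦ S ⟧ = Smat

evalWord : List Generator → M2
evalWord = foldr (λ g M → ⟦ g ⟧ ·M M) Imat

length₄ : List Generator → Z4
length₄ = foldr (λ _ k → 1₄ +₄ k) 0₄

det-⟦⟧ : ∀ g → detM ⟦ g ⟧ ≡ oneZ4
det-⟦⟧ T = refl
det-⟦⟧ S = refl

det-⟦⟧-·M : ∀ g M → detM (⟦ g ⟧ ·M M) ≡ detM M
det-⟦⟧-·M T = from-yes (all-M2? λ M → detM (Tmat ·M M) ≟₄ detM M)
det-⟦⟧-·M S = from-yes (all-M2? λ M → detM (Smat ·M M) ≟₄ detM M)

det-evalWord : ∀ w → detM (evalWord w) ≡ oneZ4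
det-evalWord [] = refl
det-evalWord (g ∷ w) = trans (det-⟦⟧-·M g (evalWord w)) (det-evalWord w)

-- M = Tˣ S Tʸ Sᶻ: for c a unit, x = ac, y = dc, z = c - 1; for c even, apply this to M S.
normalFormExponents : M2 → Z4 × Z4 × Z4
normalFormExponents (mat a _ 1₄ d) = a , d , 0₄
normalFormExponents (mat a _ 3₄ d) = 3₄ *₄ a , 3₄ *₄ d , 2₄
normalFormExponents (mat _ b c d) = b *₄ d , c , d +₄ 2₄

normalWord : M2 → List Generator
normalWord M with normalFormExponents M
... | x , y , z = replicate (toℕ x) T ++ S ∷ replicate (toℕ y) T ++ replicate (toℕ z) S

evalWord-normalWord : ∀ M → detM M ≡ oneZ4 → evalWord (normalWord M) ≡ M
evalWord-normalWord = from-yes (all-M2? λ M → detM M ≟₄ oneZ4 →-dec evalWord (normalWord M) ≟M M)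

φ₀ : M2 → Z4
φ₀ M = length₄ (normalWord M)

idempotent₄ : ∀ x → x ≡ x +₄ x → x ≡ 0₄
idempotent₄ 0₄ _ = refl
idempotent₄ 1₄ ()
idempotent₄ 2₄ ()
idempotent₄ 3₄ ()

-- Written additively, (ST)³ = S² and φ T = 1 leave φ S = 1 as the only possibility.
ST-relation : evalWord (S ∷ T ∷ S ∷ T ∷ S ∷ T ∷ []) ≡ evalWord (S ∷ S ∷ [])
ST-relation = refl

φ-S-forced : ∀ s t → t ≡ 1₄ →
  s +₄ (t +₄ (s +₄ (t +₄ (s +₄ (t +₄ 0₄))))) ≡ s +₄ (s +₄ 0₄) → s ≡ 1₄
φ-S-forced 0₄ _ refl ()
φ-S-forced 1₄ _ refl _ = refl
φ-S-forced 2₄ _ refl ()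
φ-S-forced 3₄ _ refl ()

module _ {φ : M2 → Z4} (isφ : IsPhi φ) where

  private
    φ-hom : ∀ {A B} → detM A ≡ oneZ4 → detM B ≡ oneZ4 → φ (A ·M B) ≡ φ A +₄ φ B
    φ-hom = proj₁ isφ _ _

  φ-Imat : φ Imat ≡ 0₄
  φ-Imat = idempotent₄ (φ Imat) (φ-hom refl refl)

  φ-evalWord : ∀ w → φ (evalWord w) ≡ foldr (λ g k → φ ⟦ g ⟧ +₄ k) 0₄ w
  φ-evalWord [] = φ-Imat
  φ-evalWord (g ∷ w) = trans (φ-hom (det-⟦⟧ g) (det-evalWord w)) (cong (φ ⟦ g ⟧ +₄_) (φ-evalWord w))

  φ-⟦⟧ : ∀ g → φ ⟦ g ⟧ ≡ 1₄
  φ-⟦⟧ T = proj₂ isφ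
  φ-⟦⟧ S = φ-S-forced (φ Smat) (φ Tmat) (proj₂ isφ)
    (trans (sym (φ-evalWord (S ∷ T ∷ S ∷ T ∷ S ∷ T ∷ []))) (trans (cong φ ST-relation) (φ-evalWord (S ∷ S ∷ []))))

  φ-evalWord-length : ∀ w → φ (evalWord w) ≡ length₄ w
  φ-evalWord-length [] = φ-Imat
  φ-evalWord-length (g ∷ w) =
    trans (φ-hom (det-⟦⟧ g) (det-evalWord w)) (cong₂ _+₄_ (φ-⟦⟧ g) (φ-evalWord-length w))

  φ-unique : ∀ M → detM M ≡ oneZ4 → φ M ≡ φ₀ M
  φ-unique M det≡1 = trans (cong φ (sym (evalWord-normalWord M det≡1))) (φ-evalWord-length (normalWord M))

-- Dependence of ε on D modulo 32 and on λ modulo 4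

infix 4 _≈₄[_]_
record _≈₄[_]_ (u : O2) (n : ℕ) (v : O2) : Set where
  constructor _,_
  field
    proj₁-≡ : proj₁ u n ≡ proj₁ v n [mod 4 ]
    proj₂-≡ : proj₂ u n ≡ proj₂ v n [mod 4 ]

module _ {n : ℕ} where

  ≈₄-reflexive : ∀ {u v} → u ≡ v → u ≈₄[ n ] v
  ≈₄-reflexive refl = ≡-mod-refl , ≡-mod-refl

  ≈₄-sym : ∀ {u v} → u ≈₄[ n ] v → v ≈₄[ n ] u
  ≈₄-sym (a≡ , b≡) = ≡-mod-sym a≡ , ≡-mod-sym b≡

  ≈₄-trans : ∀ {u v w} → u ≈₄[ n ] v → v ≈₄[ n ] w → u ≈₄[ n ] w
  ≈₄-trans (a≡ , b≡) (a≡′ , b≡′) = ≡-mod-trans a≡ a≡′ , ≡-mod-trans b≡ b≡′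

Cong4⇒≈₄ : ∀ {u v} → Cong4 u v → u ≈₄[ 2 ] v
Cong4⇒≈₄ (_ , _ , 4∣a , 4∣b) = ∣-multiple⇒≡-mod (4∣a 2) , ∣-multiple⇒≡-mod (4∣b 2)

residues₄ : O2 → Z4 × Z4
residues₄ u = red4 (proj₁ u 2) , red4 (proj₂ u 2)

residues₄-cong : ∀ {u v} → u ≈₄[ 2 ] v → residues₄ u ≡ residues₄ v
residues₄-cong (a≡ , b≡) = cong₂ _,_ (red4-cong a≡) (red4-cong b≡)

module _ {D D′ : ℤ} (D≡D′ : D ≡ D′ [mod 32 ]) where

  private
    %ℕ-cong-32 : ∀ m .{{_ : ℕ.NonZero m}} → m ℕ.∣ 32 → D %ℕ m ≡ D′ %ℕ m
    %ℕ-cong-32 m m∣32 = %ℕ-cong m (≡-mod-weaken m∣32 D≡D′)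

    isOdd-cong : isOdd D ≡ isOdd D′
    isOdd-cong = cong (ℕ._≡ᵇ 1) (%ℕ-cong-32 2 (divides 16 refl))

    mod8-cong : (D %ℕ 8 ℕ.≡ᵇ 1) ≡ (D′ %ℕ 8 ℕ.≡ᵇ 1)
    mod8-cong = cong (ℕ._≡ᵇ 1) (%ℕ-cong-32 8 (divides 4 refl))

    case3-cong : case3 D ≡ case3 D′
    case3-cong = cong (λ r → (r ℕ.≡ᵇ 4) ∨ (r ℕ.≡ᵇ 8)) (%ℕ-cong-32 32 (divides 1 refl))

  D4or8-cong : D4or8 D ≡ D4or8 D′
  D4or8-cong = cong (λ r → (r ℕ.≡ᵇ 4) ∨ (r ℕ.≡ᵇ 8)) (%ℕ-cong-32 16 (divides 2 refl))

  trτ-cong : trτ D ≡ trτ D′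
  trτ-cong rewrite isOdd-cong | mod8-cong | case3-cong = refl

  sqrtO-cong : sqrtO D ≡ sqrtO D′
  sqrtO-cong rewrite isOdd-cong | mod8-cong | case3-cong = refl

  nmτ-cong : nmτ D ≡ nmτ D′ [mod 8 ]
  nmτ-cong rewrite isOdd-cong | case3-cong with isOdd D′ | case3 D′
  ... | true  | _     = /ℕ-cong 4 8 (+-cong-mod (≡-mod-refl {x = + 9}) (neg-cong-mod D≡D′))
  ... | false | true  = +-cong-mod (≡-mod-refl {x = + 9}) (/ℕ-cong 4 8 (neg-cong-mod D≡D′))
  ... | false | false = /ℕ-cong 4 8 (neg-cong-mod D≡D′)

  private
    tr≡ : trτ D ≡ trτ D′ [mod 4 ]
    tr≡ = ≡-mod-reflexive (trτ-cong)

    nm≡ : nmτ D ≡ nmτ D′ [mod 4 ]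
    nm≡ = ≡-mod-weaken (divides 2 refl) (nmτ-cong)

  module _ {n : ℕ} where

    mulO-cong : ∀ {u u′ v v′} → u ≈₄[ n ] u′ → v ≈₄[ n ] v′ → mulO D u v ≈₄[ n ] mulO D′ u′ v′
    mulO-cong (a≡ , b≡) (c≡ , d≡) =
      -‿cong-mod (*-cong-mod a≡ c≡) (*-cong-mod nm≡ (*-cong-mod b≡ d≡)) ,
      +-cong-mod (+-cong-mod (*-cong-mod a≡ d≡) (*-cong-mod b≡ c≡)) (*-cong-mod tr≡ (*-cong-mod b≡ d≡))

    normO-cong : ∀ {l l′} → l ≈₄[ n ] l′ → normO D l n ≡ normO D′ l′ n [mod 4 ]
    normO-cong (a≡ , b≡) =
      +-cong-mod (+-cong-mod (*-cong-mod a≡ a≡) (*-cong-mod tr≡ (*-cong-mod a≡ b≡))) (*-cong-mod nm≡ (*-cong-mod b≡ b≡))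

    -- Modulo 8 the cross term only sees a b modulo 4 because the trace is even.
    normO-cong-mod8 : ∀ {l l′} → trτ D %ℕ 2 ≡ 0 → l ≈₄[ n ] l′ → normO D l n ≡ normO D′ l′ n [mod 8 ]
    normO-cong-mod8 tr-even (a≡ , b≡) rewrite sym (trτ-cong) =
      +-cong-mod (+-cong-mod (square-cong-mod8 a≡) (even-*-cong-mod8 {t = trτ D} tr-even (*-cong-mod a≡ b≡)))
                 (*-cong-mod (nmτ-cong) (square-cong-mod8 b≡))

    +O-cong : ∀ {u u′ v v′} → u ≈₄[ n ] u′ → v ≈₄[ n ] v′ → (u +O v) ≈₄[ n ] (u′ +O v′)
    +O-cong (a≡ , b≡) (c≡ , d≡) = +-cong-mod a≡ c≡ , +-cong-mod b≡ d≡

  elt-cong : ∀ x y → elt D x y ≈₄[ 2 ] elt D′ x y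
  elt-cong x y = +O-cong (≈₄-reflexive {u = constO x (+ 0)} refl)
    (mulO-cong (≈₄-reflexive {u = constO y (+ 0)} refl) (≈₄-reflexive (sqrtO-cong)))

  cubeO-cong : ∀ {l l′} → l ≈₄[ 2 ] l′ → cubeO D l ≈₄[ 2 ] cubeO D′ l′
  cubeO-cong l≈ = mulO-cong l≈ (mulO-cong l≈ l≈)

  δmat-cong : ∀ {l l′} → l ≈₄[ 2 ] l′ → δmat D l ≡ δmat D′ l′
  δmat-cong {l} {l′} l≈@(a≡ , b≡) =
    mat-cong (red4-cong (+-cong-mod a≡ (*-cong-mod tr≡ b≡))) (red4-cong (neg-cong-mod (*-cong-mod nm≡ b≡)))
             (cong₂ _*₄_ N⁻¹≡ (red4-cong b≡)) (cong₂ _*₄_ N⁻¹≡ (red4-cong a≡))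
    where
    N⁻¹≡ : inv4 (red4 (normO D l 2)) ≡ inv4 (red4 (normO D′ l′ 2))
    N⁻¹≡ = cong inv4 (red4-cong (normO-cong l≈))

  halfExp-cong : ∀ {l l′} → trτ D %ℕ 2 ≡ 0 → l ≈₄[ 3 ] l′ → halfExp D l ≡ halfExp D′ l′
  halfExp-cong tr-even l≈ = cong (λ r → ((r ℕ.∸ 1) ℕ./ 2) mod 4) (%ℕ-cong 8 (normO-cong-mod8 tr-even l≈))

residue₃₂ : ℤ → Fin 32
residue₃₂ D = (D %ℕ 32) mod 32

reduce₃₂ : ℤ → ℤ
reduce₃₂ D = + toℕ (residue₃₂ D)

≡-mod-reduce₃₂ : ∀ D → D ≡ reduce₃₂ D [mod 32 ]
≡-mod-reduce₃₂ = ≡-mod-remainder 32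

D4or8⇒trτ-even : ∀ D → D4or8 D ≡ true → trτ D %ℕ 2 ≡ 0
D4or8⇒trτ-even D D4or8≡true =
  subst (λ t → t %ℕ 2 ≡ 0) (sym (trτ-cong D≡D₀)) (on-residues (residue₃₂ D) (trans (sym (D4or8-cong D≡D₀)) D4or8≡true))
  where
  D≡D₀ : D ≡ reduce₃₂ D [mod 32 ]
  D≡D₀ = ≡-mod-reduce₃₂ D
  on-residues : ∀ ρ → D4or8 (+ toℕ ρ) ≡ true → trτ (+ toℕ ρ) %ℕ 2 ≡ 0
  on-residues = from-yes (all? λ (ρ : Fin 32) → D4or8 (+ toℕ ρ) Bool.≟ true →-dec trτ (+ toℕ ρ) %ℕ 2 ℕ.≟ 0)

ετ-cong : ∀ {D D′ φ φ′ l l′} → D ≡ D′ [mod 32 ] → l ≈₄[ 3 ] l′ →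
          φ (δmat D l) ≡ φ′ (δmat D′ l′) → ετ D φ l ≡ ετ D′ φ′ l′
ετ-cong {D} {D′} D≡D′ l≈ φδ≡ rewrite D4or8-cong D≡D′ with D4or8 D′ in D4or8≡
... | true  = cong₂ _+₄_ (halfExp-cong D≡D′ (D4or8⇒trτ-even D (trans (D4or8-cong D≡D′) D4or8≡)) l≈) φδ≡
... | false = φδ≡

reduce₄ : O2 → O2
reduce₄ l = constO (lift4 (red4 (proj₁ l 2))) (lift4 (red4 (proj₂ l 2)))

≈₄[2]-reduce₄ : ∀ l → l ≈₄[ 2 ] reduce₄ l
≈₄[2]-reduce₄ l = ≡-mod-remainder 4 (proj₁ l 2) , ≡-mod-remainder 4 (proj₂ l 2)

≈₄[3]-reduce₄ : ∀ {l} → IsO2 l → l ≈₄[ 3 ] reduce₄ l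
≈₄[3]-reduce₄ {l} (a∈ℤ₂ , b∈ℤ₂) =
  ≡-mod-trans (∣⇒≡-mod (a∈ℤ₂ 2)) (≡-mod-remainder 4 (proj₁ l 2)) ,
  ≡-mod-trans (∣⇒≡-mod (b∈ℤ₂ 2)) (≡-mod-remainder 4 (proj₂ l 2))

ετ-reduce : ∀ {D φ l} → IsPhi φ → IsO2 l →
            detM (δmat (reduce₃₂ D) (reduce₄ l)) ≡ oneZ4 →
            ετ D φ l ≡ ετ (reduce₃₂ D) φ₀ (reduce₄ l)
ετ-reduce {D} {φ} {l} isφ l∈O₂ det≡1 =
  ετ-cong {φ = φ} {φ₀} {l} {reduce₄ l} D≡D₀ (≈₄[3]-reduce₄ l∈O₂) (begin
    φ (δmat D l)                        ≡⟨ cong φ (δmat-cong D≡D₀ (≈₄[2]-reduce₄ l)) ⟩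
    φ (δmat (reduce₃₂ D) (reduce₄ l))   ≡⟨ φ-unique {φ} isφ (δmat (reduce₃₂ D) (reduce₄ l)) det≡1 ⟩
    φ₀ (δmat (reduce₃₂ D) (reduce₄ l))  ∎)
  where
  D≡D₀ : D ≡ reduce₃₂ D [mod 32 ]
  D≡D₀ = ≡-mod-reduce₃₂ D

-- Reduction to a finite computation

⋁ : {A : Set} → (A → Set) → A → List A → Set
⋁ P x []       = P x
⋁ P x (y ∷ ys) = P x ⊎ ⋁ P y ys

⋁⇒Any : ∀ {A : Set} {P : A → Set} x xs → ⋁ P x xs → Any P (x ∷ xs)
⋁⇒Any x []       p        = here p
⋁⇒Any x (y ∷ ys) (inj₁ p) = here p
⋁⇒Any x (y ∷ ys) (inj₂ p) = there (⋁⇒Any y ys p)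

Discriminant : ℤ → Set
Discriminant D = D %ℕ 4 ≡ 0 ⊎ D %ℕ 4 ≡ 1

RespectsResidues : (ℤ → O2 → O2) → Set
RespectsResidues f = ∀ {D D′ u u′} → D ≡ D′ [mod 32 ] → u ≈₄[ 2 ] u′ → f D u ≈₄[ 2 ] f D′ u′

ValueOnResidues : (m k : ℕ) .{{_ : ℕ.NonZero m}} → (ℤ → O2 → O2) → List (ℤ × ℤ) → Z4 → Set
ValueOnResidues m k f targets v =
  (ρ : Fin 32) (A B : Z4) → let D = + toℕ ρ ; l = constO (lift4 A) (lift4 B) in
  Discriminant D → D %ℕ m ≡ k → Any (λ t → residues₄ (f D l) ≡ residues₄ (uncurry (elt D) t)) targets →
  detM (δmat D l) ≡ oneZ4 × ετ D φ₀ l ≡ v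

valueOnResidues? : ∀ m k .{{_ : ℕ.NonZero m}} f targets v → Dec (ValueOnResidues m k f targets v)
valueOnResidues? m k f targets v =
  all? λ ρ → all? λ A → all? λ B → let D = + toℕ ρ ; l = constO (lift4 A) (lift4 B) in
  (D %ℕ 4 ℕ.≟ 0 ⊎-dec D %ℕ 4 ℕ.≟ 1) →-dec D %ℕ m ℕ.≟ k →-dec
  any? (λ t → ≡-dec _≟₄_ _≟₄_ (residues₄ (f D l)) (residues₄ (uncurry (elt D) t))) targets →-dec
  (detM (δmat D l) ≟₄ oneZ4 ×-dec ετ D φ₀ l ≟₄ v)

module ValuesByResidues {D : ℤ} {φ : M2 → Z4} {l : O2} (disc : Discriminant D) (isφ : IsPhi φ) (l∈O₂ : IsO2 l) where

  private
    D≡D₀ : D ≡ reduce₃₂ D [mod 32 ]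
    D≡D₀ = ≡-mod-reduce₃₂ D

    %ℕ-reduce₃₂ : ∀ m .{{_ : ℕ.NonZero m}} → m ℕ.∣ 32 → reduce₃₂ D %ℕ m ≡ D %ℕ m
    %ℕ-reduce₃₂ m m∣32 = sym (%ℕ-cong m (≡-mod-weaken m∣32 D≡D₀))

  ετ-from-residues : ∀ f → RespectsResidues f → ∀ m k .{{_ : ℕ.NonZero m}} → m ℕ.∣ 32 → ∀ t ts v →
                     {_ : True (valueOnResidues? m k f (t ∷ ts) v)} →
                     D %ℕ m ≡ k → ⋁ (λ t → Cong4 (f D l) (uncurry (elt D) t)) t ts → ετ D φ l ≡ v
  ετ-from-residues f f-resp m k m∣32 t ts v {table} D≡k congruences =
    trans (ετ-reduce {D} {φ} {l} isφ l∈O₂ (proj₁ on-residues)) (proj₂ on-residues)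
    where
    disc₀ : Discriminant (reduce₃₂ D)
    disc₀ = Sum.map (trans (%ℕ-reduce₃₂ 4 (divides 8 refl))) (trans (%ℕ-reduce₃₂ 4 (divides 8 refl))) disc
    transfer : ∀ {t} → Cong4 (f D l) (uncurry (elt D) t) →
               residues₄ (f (reduce₃₂ D) (reduce₄ l)) ≡ residues₄ (uncurry (elt (reduce₃₂ D)) t)
    transfer {x , y} l≡ = residues₄-cong (≈₄-trans (≈₄-sym (f-resp D≡D₀ (≈₄[2]-reduce₄ l)))
                                           (≈₄-trans (Cong4⇒≈₄ l≡) (elt-cong D≡D₀ x y)))
    on-residues : detM (δmat (reduce₃₂ D) (reduce₄ l)) ≡ oneZ4 × ετ (reduce₃₂ D) φ₀ (reduce₄ l) ≡ v
    on-residues = toWitness table (residue₃₂ D) _ _ disc₀ (trans (%ℕ-reduce₃₂ m m∣32) D≡k)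
                    (Any.map (λ {t} → transfer {t}) (⋁⇒Any t ts congruences))

  ετ-from-class : ∀ k t ts v {_ : True (valueOnResidues? 16 k (λ _ u → u) (t ∷ ts) v)} →
                  D %ℕ 16 ≡ k → ⋁ (λ t → Cong4 l (uncurry (elt D) t)) t ts → ετ D φ l ≡ v
  ετ-from-class k t ts v {table} = ετ-from-residues (λ _ u → u) (λ _ u≈ → u≈) 16 k (divides 2 refl) t ts v {table}

  ετ-from-cube-class : ∀ t ts v {_ : True (valueOnResidues? 2 1 cubeO (t ∷ ts) v)} →
                       D %ℕ 2 ≡ 1 → ⋁ (λ t → Cong4 (cubeO D l) (uncurry (elt D) t)) t ts → ετ D φ l ≡ v
  ετ-from-cube-class t ts v {table} = ετ-from-residues cubeO (λ D≡D′ → cubeO-cong D≡D′) 2 1 (divides 16 refl) t ts v {table}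

proposition6p2 :
  (D : ℤ) → D < + 0 → (D %ℕ 4 ≡ 0 ⊎ D %ℕ 4 ≡ 1) →
  (φ : M2 → Z4) → IsPhi φ →
  (l : O2) → IsO2 l → IsUnitO D l →
  -- D odd
  (D %ℕ 2 ≡ 1 →
    ((Cong4 (cubeO D l) (elt D (+ 1) (+ 0)) ⊎ Cong4 (cubeO D l) (elt D (+ 0) (- + 1))) → ετ D φ l ≡ μ1)
    × ((Cong4 (cubeO D l) (elt D (- + 1) (+ 0)) ⊎ Cong4 (cubeO D l) (elt D (+ 0) (+ 1))) → ετ D φ l ≡ μ-1))
  -- D ≡ 4 (mod 16)
  × (D %ℕ 16 ≡ 4 →
    ((Cong4 l (elt D (+ 1) (+ 0)) ⊎ Cong4 l (elt D (+ 0) (+ 1))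
       ⊎ Cong4 l (elt D (- + 1) (+ 2)) ⊎ Cong4 l (elt D (+ 2) (- + 1))) → ετ D φ l ≡ μ1)
    × ((Cong4 l (elt D (- + 1) (+ 0)) ⊎ Cong4 l (elt D (+ 0) (- + 1))
       ⊎ Cong4 l (elt D (+ 1) (+ 2)) ⊎ Cong4 l (elt D (+ 2) (+ 1))) → ετ D φ l ≡ μ-1))
  -- D ≡ 8 (mod 16)
  × (D %ℕ 16 ≡ 8 →
    ((Cong4 l (elt D (+ 1) (+ 0)) ⊎ Cong4 l (elt D (- + 1) (+ 2))
       ⊎ Cong4 l (elt D (+ 1) (+ 1)) ⊎ Cong4 l (elt D (- + 1) (+ 1))) → ετ D φ l ≡ μ1)
    × ((Cong4 l (elt D (- + 1) (+ 0)) ⊎ Cong4 l (elt D (+ 1) (+ 2))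
       ⊎ Cong4 l (elt D (+ 1) (- + 1)) ⊎ Cong4 l (elt D (- + 1) (- + 1))) → ετ D φ l ≡ μ-1))
  -- D ≡ 12 (mod 16)
  × (D %ℕ 16 ≡ 12 →
    ((Cong4 l (elt D (+ 1) (+ 0)) ⊎ Cong4 l (elt D (+ 1) (+ 2))) → ετ D φ l ≡ μ1)
    × ((Cong4 l (elt D (+ 2) (+ 1)) ⊎ Cong4 l (elt D (+ 0) (+ 1))) → ετ D φ l ≡ μi)
    × ((Cong4 l (elt D (- + 1) (+ 0)) ⊎ Cong4 l (elt D (- + 1) (+ 2))) → ετ D φ l ≡ μ-1)
    × ((Cong4 l (elt D (+ 2) (- + 1)) ⊎ Cong4 l (elt D (+ 0) (- + 1))) → ετ D φ l ≡ μ-i))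
  -- D ≡ 0 (mod 16)
  × (D %ℕ 16 ≡ 0 →
    ((Cong4 l (elt D (+ 1) (+ 0)) ⊎ Cong4 l (elt D (- + 1) (+ 2))) → ετ D φ l ≡ μ1)
    × ((Cong4 l (elt D (+ 1) (- + 1)) ⊎ Cong4 l (elt D (- + 1) (- + 1))) → ετ D φ l ≡ μi)
    × ((Cong4 l (elt D (- + 1) (+ 0)) ⊎ Cong4 l (elt D (+ 1) (+ 2))) → ετ D φ l ≡ μ-1)
    × ((Cong4 l (elt D (+ 1) (+ 1)) ⊎ Cong4 l (elt D (- + 1) (+ 1))) → ετ D φ l ≡ μ-i))
proposition6p2 D _ disc φ isφ l l∈O₂ _ =
    (λ h → ετ-from-cube-class (+ 1 , + 0) ((+ 0 , - + 1) ∷ []) μ1 h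
         , ετ-from-cube-class (- + 1 , + 0) ((+ 0 , + 1) ∷ []) μ-1 h)
  , (λ h → ετ-from-class 4 (+ 1 , + 0) ((+ 0 , + 1) ∷ (- + 1 , + 2) ∷ (+ 2 , - + 1) ∷ []) μ1 h
         , ετ-from-class 4 (- + 1 , + 0) ((+ 0 , - + 1) ∷ (+ 1 , + 2) ∷ (+ 2 , + 1) ∷ []) μ-1 h)
  , (λ h → ετ-from-class 8 (+ 1 , + 0) ((- + 1 , + 2) ∷ (+ 1 , + 1) ∷ (- + 1 , + 1) ∷ []) μ1 h
         , ετ-from-class 8 (- + 1 , + 0) ((+ 1 , + 2) ∷ (+ 1 , - + 1) ∷ (- + 1 , - + 1) ∷ []) μ-1 h)
  , (λ h → ετ-from-class 12 (+ 1 , + 0) ((+ 1 , + 2) ∷ []) μ1 h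
         , ετ-from-class 12 (+ 2 , + 1) ((+ 0 , + 1) ∷ []) μi h
         , ετ-from-class 12 (- + 1 , + 0) ((- + 1 , + 2) ∷ []) μ-1 h
         , ετ-from-class 12 (+ 2 , - + 1) ((+ 0 , - + 1) ∷ []) μ-i h)
  , (λ h → ετ-from-class 0 (+ 1 , + 0) ((- + 1 , + 2) ∷ []) μ1 h
         , ετ-from-class 0 (+ 1 , - + 1) ((- + 1 , - + 1) ∷ []) μi h
         , ετ-from-class 0 (- + 1 , + 0) ((+ 1 , + 2) ∷ []) μ-1 h
         , ετ-from-class 0 (+ 1 , + 1) ((- + 1 , + 1) ∷ []) μ-i h)
  where
  open ValuesByResidues {D} {φ} {l} disc isφ l∈O₂
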